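{- Let $(\mathcal{GO}_1,\dots,\mathcal{GO}_n)$ be a MaxMin optimization problem with $\mathcal{GO}_i=\langle t_i,\prec,\phi_i\rangle$ (all with the same order $\prec$), and let $\mathcal{I}$ be a $\mathcal{GO}_{\mathcal{MAXMIN}}$-solution, where $\mathcal{GO}_{\mathcal{MAXMIN}}=\langle \mathit{tup}(t_1,\dots,t_n),\prec_{\mathcal{MXMN}},\phi_1\wedge\dots\wedge\phi_n\rangle$. Then $\mathcal{I}$ is a solution to the MaxMin problem $(\mathcal{GO}_1,\dots,\mathcal{GO}_n)$.
   Context: Fix a many-sorted first-order theory $\mathcal{T}$ (including a tuple datatype with constructor $\mathit{tup}$); all interpretations are $\mathcal{T}$-interpretations assigning values to all variables. A GOMT problem is a triple $\langle t,\prec,\phi\rangle$ with $t$ a term of sort $\sigma$, $\prec$ a strict partial order on values of sort $\sigma$ definable in $\mathcal{T}$, and $\phi$ a formula; $\mathcal{I}$ is consistent with it if $\mathcal{I}\models\phi$. For a problem $\langle t,\prec',\phi\rangle$, a solution is an interpretation $\mathcal{I}\models\phi$ such that there is no $\mathcal{I}'\models\phi$ with $t^{\mathcal{I}'}\prec' t^{\mathcal{I}}$. $\preccurlyeq$ denotes the reflexive closure of $\prec$. A MaxMin problem is a sequence $(\mathcal{GO}_1,\dots,\mathcal{GO}_n)$ of GOMT problems $\mathcal{GO}_i=\langle t_i,\prec,\phi_i\rangle$ sharing the order $\prec$. $\mathcal{I}$ MaxMin-dominates $\mathcal{I}'$ if both are $\mathcal{GO}_i$-consistent for every $i$, and $t_{min}^{\mathcal{I}'}\prec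 t_{min}^{\mathcal{I}}$, where $t_{min}^{\mathcal{I}}=t_i^{\mathcal{I}}$ for some $i$ and $t_{min}^{\mathcal{I}'}=t_j^{\mathcal{I}'}$ for some $j$ with $t_{min}^{\mathcal{I}}\preccurlyeq t_k^{\mathcal{I}}$ and $t_{min}^{\mathcal{I}'}\preccurlyeq t_k^{\mathcal{I}'}$ for all $k\in[1,n]$. $\mathcal{I}$ is a solution to the MaxMin problem iff it is $\mathcal{GO}_i$-consistent for each $i$ and no interpretation MaxMin-dominates it. $(a_1,\dots,a_n)\prec_{\mathcal{MXMN}}(b_1,\dots,b_n)$ iff for some $i,j\in[1,n]$: $a_i\preccurlyeq a_k$ and $b_j\preccurlyeq b_k$ for all $k\in[1,n]$, and $b_j\prec a_i$. -}

module Defs where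

open import Data.Nat using (ℕ)
open import Data.Fin using (Fin)
open import Data.Product using (Σ; _×_; ∃; ∃-syntax)
open import Data.Sum using (_⊎_)
open import Relation.Binary.PropositionalEquality using (_≡_)
open import Relation.Nullary using (¬_)

-- Abstract setting: a type `Interp` of T-interpretations (assigning values to
-- all variables); a term t of sort σ is represented by its evaluation
-- function Interp → V (V = values of sort σ); a formula φ by its
-- satisfaction predicate Interp → Set.  A tuple term tup(t₁,…,tₙ) evaluates
-- to the tuple of values, represented as Fin n → V.

_⟨_⟩≼_ : {V : Set} → V → (V → V → Set) → V → Set
a ⟨ _≺_ ⟩≼ b = a ≡ b ⊎ a ≺ b

GOMTSolution : {Interp A : Set} → (Interp → A) → (A → A → Set)
             → (Interp → Set) → Interp → Set
GOMTSolution {Interp} t _≺'_ φ I =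
  φ I × ((I' : Interp) → φ I' → ¬ (t I' ≺' t I))

MXMN : {V : Set} (n : ℕ) → (V → V → Set) → (Fin n → V) → (Fin n → V) → Set
MXMN n _≺_ a b =
  ∃[ i ] ∃[ j ] (((k : Fin n) → a i ⟨ _≺_ ⟩≼ a k)
               × ((k : Fin n) → b j ⟨ _≺_ ⟩≼ b k)
               × (b j ≺ a i))

MaxMinDominates : {Interp V : Set} (n : ℕ) → (V → V → Set)
                → (Fin n → Interp → V) → (Fin n → Interp → Set)
                → Interp → Interp → Set
MaxMinDominates n _≺_ t φ I I' =
  ((i : Fin n) → φ i I) × ((i : Fin n) → φ i I')
  × ∃[ i ] ∃[ j ] (((k : Fin n) → t i I ⟨ _≺_ ⟩≼ t k I)
                 × ((k : Fin n) → t j I' ⟨ _≺_ ⟩≼ t k I')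
                 × (t j I' ≺ t i I))

MaxMinSolution : {Interp V : Set} (n : ℕ) → (V → V → Set)
               → (Fin n → Interp → V) → (Fin n → Interp → Set)
               → Interp → Set
MaxMinSolution {Interp} n _≺_ t φ I =
  ((i : Fin n) → φ i I)
  × ((I' : Interp) → ¬ MaxMinDominates n _≺_ t φ I' I)

module Submission where

open import Defs
open import Data.Nat using (ℕ)
open import Data.Fin using (Fin)
open import Data.Product using (_,_)
open import Relation.Binary.PropositionalEquality using (_≡_)
open import Relation.Binary.Structures using (IsStrictPartialOrder)

-- The minima witnessing MaxMin-domination are exactly those witnessing the
-- ≺_MXMN comparison of the value tuples; no property of ≺ is needed.
maxMinDominates⇒MXMN : {Interp V : Set} (n : ℕ) (_≺_ : V → V → Set)
                       (t : Fin n → Interp → V) (φ : Fin n → Interp → Set)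
                       {I I' : Interp}
                     → MaxMinDominates n _≺_ t φ I' I
                     → MXMN n _≺_ (λ i → t i I') (λ i → t i I)
maxMinDominates⇒MXMN n _≺_ t φ (_ , _ , i , j , minI' , minI , I≺I') =
  i , j , minI' , minI , I≺I'

proposition4 : (Interp V : Set) (_≺_ : V → V → Set)
               → IsStrictPartialOrder _≡_ _≺_
               → (n : ℕ) (t : Fin n → Interp → V) (φ : Fin n → Interp → Set)
               → (I : Interp)
               → GOMTSolution (λ J → λ i → t i J) (MXMN n _≺_)
                              (λ J → (i : Fin n) → φ i J) I
               → MaxMinSolution n _≺_ t φ I
proposition4 Interp V _≺_ _ n t φ I (φI , optimal) =
  φI , λ I' dominates@(φI' , _) →
         optimal I' φI' (maxMinDominates⇒MXMN n _≺_ t φ dominates)
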